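{- Let $x:\mathbb{N}_+\to\mathbb{N}$ be non-decreasing and $n\ge1$. Then $$0=\sum_{k=0}^{n}(-1)^{n-k+1}\binom{n}{k}\,P(x;k)\,x(k+1)^{\,n-k},$$ where $P(x;k)$ is the number of $x$-parking functions on a set of cardinality $k$ (with $P(x;0)=1$).
   Context: An $x$-parking function on a finite set $U$ with $|U|=u$ is a map $f:U\to\mathbb{N}_+$ with $|f^{ -1}(\{1,\dots,x(k)\})|\ge k$ for all $1\le k\le u$. -}

module Defs where

open import Data.Nat using (ℕ; zero; suc; _≤_; _≤?_)
open import Data.Nat.Combinatorics using (_C_)
open import Data.Fin using (Fin; toℕ)
open import Data.Fin.Properties using (all?)
open import Data.List using (List; []; _∷_; length; filter; map; concatMap; allFin)
open import Data.Integer using (ℤ; +_; -_; _*_; _+_)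
open import Relation.Nullary using (Dec)

-- x : ℕ₊ → ℕ is modelled as x : ℕ → ℕ; only the values x 1, x 2, … matter.
NonDecreasing : (ℕ → ℕ) → Set
NonDecreasing x = ∀ i j → 1 ≤ i → i ≤ j → x i ≤ x j

-- |f⁻¹({1,…,m})| for f : Fin u → ℕ₊ (values of f are assumed ≥ 1)
preimageCount : ∀ {u} → (Fin u → ℕ) → ℕ → ℕ
preimageCount {u} f m = length (filter (λ i → f i ≤? m) (allFin u))

IsParking : (x : ℕ → ℕ) (u : ℕ) → (Fin u → ℕ) → Set
IsParking x u f = ∀ (j : Fin u) → suc (toℕ j) ≤ preimageCount f (x (suc (toℕ j)))

isParking? : ∀ x u f → Dec (IsParking x u f)
isParking? x u f = all? (λ j → suc (toℕ j) ≤? preimageCount f (x (suc (toℕ j))))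

allFuns : (u m : ℕ) → List (Fin u → Fin m)
allFuns zero m = (λ ()) ∷ []
allFuns (suc u) m =
  concatMap (λ g → map (λ a → λ { Fin.zero → a ; (Fin.suc i) → g i }) (allFin m)) (allFuns u m)

-- Any x-parking function on a
-- u-set takes values in {1,…,x(u)} (condition k = u), so it suffices to
-- enumerate maps Fin u → {1,…,x u} (encoded as i ↦ suc (toℕ (g i))).
-- For u = 0 this gives 1 (the empty map).
P : (x : ℕ → ℕ) → ℕ → ℕ
P x u = length (filter (λ g → isParking? x u (λ i → suc (toℕ (g i)))) (allFuns u (x u)))

negOnePow : ℕ → ℤ
negOnePow zero = + 1
negOnePow (suc m) = - negOnePow m

sumTo : ℕ → (ℕ → ℤ) → ℤ
sumTo zero f = f 0
sumTo (suc n) f = sumTo n f + f (suc n)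

-- For 0 ≤ k ≤ n, the k-th term C(n,k) P(x;k) x(k+1)^(n-k) counts the pairs (F, p) of a word
-- F ∈ {1,…,x(n+1)}^n and a k-subset p of its positions such that every letter of F is at most x(k+1)
-- and the subword F|p is an x-parking word: choose p, a parking word of length k (its letters are
-- automatically ≤ x(k) ≤ x(k+1)) and the n-k letters outside p freely in {1,…,x(k+1)}.  So the
-- alternating sum equals
-- Σ_F Σ_p (-1)^(n-|p|+1) [(F,p) valid at level |p|].  For a fixed F, let i be a position of a
-- maximal letter m.  Adding i to a subset p ∌ i raises the count of letters ≤ t only for t ≥ m, and at
-- such levels every letter of F is counted; hence (F,p) is valid at level |p| iff (F,p ∪ {i}) is valid
-- at level |p|+1.  Toggling i is thus a sign-reversing involution and every inner sum vanishes.
module Submission where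

open import Defs

open import Data.Bool using (true; false; not; if_then_else_)
open import Data.Bool.Properties using (not-involutive)
open import Data.Empty using (⊥-elim)
open import Data.Fin using (Fin; toℕ; fromℕ<)
import Data.Fin as Fin
open import Data.Fin.Properties using (toℕ-fromℕ<; toℕ<n)
import Data.Fin.Properties as Fin
open import Data.Fin.Subset using (Subset; inside; outside; ∣_∣)
open import Data.Fin.Subset.Properties using (∣p∣≤n)
open import Data.Integer using (ℤ; +_; 0ℤ; 1ℤ; -1ℤ; _+_; _*_; -_)
open import Data.Integer.Properties
  using (+-identityˡ; +-identityʳ; +-comm; +-assoc; +-commutativeSemigroup; *-identityˡ; *-zeroˡ; *-zeroʳ;
         *-comm; *-assoc; *-distribˡ-+; *-distribʳ-+; pos-+; pos-*; -1*i≡-i; neg-involutive; neg-distribˡ-*)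
open import Algebra.Properties.CommutativeSemigroup +-commutativeSemigroup using (interchange)
open import Data.Integer.Tactic.RingSolver using () renaming (solve-∀ to ℤ-solve-∀)
open import Data.List using (List; []; _∷_; [_]; _++_; map; concatMap; filter; length; applyUpTo)
import Data.List as List
open import Data.List.Properties
  using (map-∘; map-tabulate; map-concatMap; concatMap-map; concatMap-cong; applyUpTo-∷ʳ; length-applyUpTo;
         filter-all; filter-reject; filter-++; ++-identityʳ)
open import Data.List.Relation.Unary.All.Properties using (applyUpTo⁺₁)
open import Data.Nat using (ℕ; zero; suc; _∸_; _^_; _≟_; _≤_; _<_; _≤?_; z≤n; s≤s)
import Data.Nat as ℕ
import Data.Nat.Properties as ℕ
open import Data.Nat.Combinatorics using (_C_; nCk+nC[k+1]≡[n+1]C[k+1])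
open import Data.Nat.Combinatorics.Specification using (k>n⇒nCk≡0)
open import Data.Nat.Tactic.RingSolver using (solve-∀)
open import Data.Product using (_×_; _,_; ∃-syntax)
open import Data.Sum using (inj₁; inj₂)
open import Data.Vec using (Vec; []; _∷_; lookup; updateAt; tabulate)
import Data.Vec as Vec
open import Data.Vec.Properties using (count≤n; updateAt-updateAt-local; updateAt-id; lookup∘updateAt)
open import Data.Vec.Relation.Unary.All using (All; []; _∷_)
import Data.Vec.Relation.Unary.All as All
open import Data.Vec.Relation.Unary.All.Properties using (lookup⁺)
open import Function using (_∘_; _⇔_; mk⇔; Equivalence)
import Function.Properties.Equivalence as ⇔
open import Relation.Binary.PropositionalEquality
  using (_≡_; refl; sym; trans; cong; cong₂; subst; module ≡-Reasoning)
open import Relation.Nullary using (Dec; does; yes; no; ¬_)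
open import Relation.Nullary.Decidable using (_×-dec_)
import Relation.Nullary.Decidable as Dec
open import Relation.Unary using (Pred; Decidable)

open ≡-Reasoning

private variable
  A : Set
  n : ℕ

-- Defined through `does`, so that 𝟙 (suc m ≟ suc k) and 𝟙 (m ≟ k) are definitionally equal.
𝟙 : ∀ {p} {P : Set p} → Dec P → ℤ
𝟙 d = if does d then 1ℤ else 0ℤ

𝟙-yes : ∀ {p} {P : Set p} → P → (P? : Dec P) → 𝟙 P? ≡ 1ℤ
𝟙-yes _ (yes _) = refl
𝟙-yes p (no ¬p) = ⊥-elim (¬p p)

𝟙-no : ∀ {p} {P : Set p} → ¬ P → (P? : Dec P) → 𝟙 P? ≡ 0ℤ
𝟙-no ¬p (yes p) = ⊥-elim (¬p p)
𝟙-no _ (no _) = refl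

𝟙-× : ∀ {p q} {P : Set p} {Q : Set q} (P? : Dec P) (Q? : Dec Q) → 𝟙 (P? ×-dec Q?) ≡ 𝟙 P? * 𝟙 Q?
𝟙-× P? Q? with does P? | does Q?
... | true | true = refl
... | true | false = refl
... | false | _ = refl

𝟙-⇔ : ∀ {p q} {P : Set p} {Q : Set q} → P ⇔ Q → (P? : Dec P) (Q? : Dec Q) → 𝟙 P? ≡ 𝟙 Q?
𝟙-⇔ P⇔Q (yes _) (yes _) = refl
𝟙-⇔ P⇔Q (no _) (no _) = refl
𝟙-⇔ P⇔Q (yes p) (no ¬q) = ⊥-elim (¬q (Equivalence.to P⇔Q p))
𝟙-⇔ P⇔Q (no ¬p) (yes q) = ⊥-elim (¬p (Equivalence.from P⇔Q q))

𝟙-*-implied : ∀ {p q} {P : Set p} {Q : Set q} → (Q → P) → (P? : Dec P) (Q? : Dec Q) → 𝟙 P? * 𝟙 Q? ≡ 𝟙 Q?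
𝟙-*-implied Q⇒P P? (no _) = *-zeroʳ (𝟙 P?)
𝟙-*-implied Q⇒P (yes _) (yes _) = refl
𝟙-*-implied Q⇒P (no ¬p) (yes q) = ⊥-elim (¬p (Q⇒P q))

∑ : List A → (A → ℤ) → ℤ
∑ [] f = 0ℤ
∑ (a ∷ as) f = f a + ∑ as f

infix 6.5 ∑
syntax ∑ L (λ a → e) = ∑[ a ∈ L ] e

∑-cong : ∀ (L : List A) {f g : A → ℤ} → (∀ a → f a ≡ g a) → ∑ L f ≡ ∑ L g
∑-cong [] f≗g = refl
∑-cong (a ∷ L) f≗g = cong₂ _+_ (f≗g a) (∑-cong L f≗g)

∑-0 : ∀ (L : List A) → ∑[ a ∈ L ] 0ℤ ≡ 0ℤ
∑-0 [] = refl
∑-0 (a ∷ L) = trans (+-identityˡ _) (∑-0 L)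

∑-+ : ∀ (L : List A) (f g : A → ℤ) → ∑[ a ∈ L ] (f a + g a) ≡ ∑ L f + ∑ L g
∑-+ [] f g = refl
∑-+ (a ∷ L) f g = begin
  (f a + g a) + (∑[ b ∈ L ] (f b + g b)) ≡⟨ cong (_+_ (f a + g a)) (∑-+ L f g) ⟩
  (f a + g a) + (∑ L f + ∑ L g)         ≡⟨ interchange (f a) (g a) _ _ ⟩
  (f a + ∑ L f) + (g a + ∑ L g)         ∎

∑-*ˡ : ∀ (L : List A) c (f : A → ℤ) → ∑[ a ∈ L ] (c * f a) ≡ c * ∑ L f
∑-*ˡ [] c f = sym (*-zeroʳ c)
∑-*ˡ (a ∷ L) c f = trans (cong (_+_ (c * f a)) (∑-*ˡ L c f)) (sym (*-distribˡ-+ c (f a) _))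

∑-*ʳ : ∀ (L : List A) (f : A → ℤ) c → ∑[ a ∈ L ] f a * c ≡ ∑ L f * c
∑-*ʳ L f c = begin
  ∑[ a ∈ L ] f a * c   ≡⟨ ∑-cong L (λ a → *-comm (f a) c) ⟩
  ∑[ a ∈ L ] c * f a   ≡⟨ ∑-*ˡ L c f ⟩
  c * ∑ L f            ≡⟨ *-comm c (∑ L f) ⟩
  ∑ L f * c            ∎

∑-neg : ∀ (L : List A) (f : A → ℤ) → ∑[ a ∈ L ] (- f a) ≡ - ∑ L f
∑-neg L f = trans (∑-cong L (λ a → sym (-1*i≡-i (f a)))) (trans (∑-*ˡ L -1ℤ f) (-1*i≡-i _))

∑-const : ∀ (L : List A) c → ∑[ a ∈ L ] c ≡ + length L * c
∑-const [] c = sym (*-zeroˡ c)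
∑-const (a ∷ L) c = begin
  c + (∑[ b ∈ L ] c)            ≡⟨ cong₂ _+_ (sym (*-identityˡ c)) (∑-const L c) ⟩
  1ℤ * c + + length L * c       ≡⟨ *-distribʳ-+ c 1ℤ (+ length L) ⟨
  (1ℤ + + length L) * c         ≡⟨ cong (_* c) (pos-+ 1 (length L)) ⟨
  + suc (length L) * c          ∎

∑-comm : ∀ {B : Set} (L : List A) (K : List B) (f : A → B → ℤ) →
  ∑[ a ∈ L ] ∑[ b ∈ K ] f a b ≡ ∑[ b ∈ K ] ∑[ a ∈ L ] f a b
∑-comm [] K f = sym (∑-0 K)
∑-comm (a ∷ L) K f = trans (cong (_+_ (∑ K (f a))) (∑-comm L K f)) (sym (∑-+ K (f a) _))

∑-++ : ∀ (L K : List A) (f : A → ℤ) → ∑ (L ++ K) f ≡ ∑ L f + ∑ K f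
∑-++ [] K f = sym (+-identityˡ _)
∑-++ (a ∷ L) K f = trans (cong (_+_ (f a)) (∑-++ L K f)) (sym (+-assoc (f a) _ _))

∑-map : ∀ {B : Set} (g : A → B) (L : List A) (f : B → ℤ) → ∑ (map g L) f ≡ ∑ L (f ∘ g)
∑-map g [] f = refl
∑-map g (a ∷ L) f = cong (_+_ (f (g a))) (∑-map g L f)

∑-concatMap : ∀ {B : Set} (g : A → List B) (L : List A) (f : B → ℤ) →
  ∑ (concatMap g L) f ≡ ∑[ a ∈ L ] ∑ (g a) f
∑-concatMap g [] f = refl
∑-concatMap g (a ∷ L) f = trans (∑-++ (g a) _ f) (cong (_+_ (∑ (g a) f)) (∑-concatMap g L f))

∑-filter : ∀ {p} {P : Pred A p} (P? : Decidable P) (L : List A) (f : A → ℤ) →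
  ∑[ a ∈ L ] (𝟙 (P? a) * f a) ≡ ∑ (filter P? L) f
∑-filter P? [] f = refl
∑-filter P? (a ∷ L) f with does (P? a)
... | true = cong₂ _+_ (*-identityˡ (f a)) (∑-filter P? L f)
... | false = trans (cong₂ _+_ (*-zeroˡ (f a)) (∑-filter P? L f)) (+-identityˡ _)

∑-𝟙 : ∀ {p} {P : Pred A p} (P? : Decidable P) (L : List A) → ∑[ a ∈ L ] 𝟙 (P? a) ≡ + length (filter P? L)
∑-𝟙 P? [] = refl
∑-𝟙 P? (a ∷ L) with does (P? a)
... | true = trans (cong (_+_ 1ℤ) (∑-𝟙 P? L)) (sym (pos-+ 1 _))
... | false = trans (+-identityˡ _) (∑-𝟙 P? L)

i≡-i⇒i≡0 : ∀ {i} → i ≡ - i → i ≡ 0ℤ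
i≡-i⇒i≡0 {+ zero} _ = refl

sumTo-cong : ∀ n {f g : ℕ → ℤ} → (∀ k → k ≤ n → f k ≡ g k) → sumTo n f ≡ sumTo n g
sumTo-cong zero f≗g = f≗g 0 z≤n
sumTo-cong (suc n) f≗g = cong₂ _+_ (sumTo-cong n (λ k k≤n → f≗g k (ℕ.m≤n⇒m≤1+n k≤n))) (f≗g (suc n) ℕ.≤-refl)

sumTo-*-∑ : ∀ n (L : List A) (c : ℕ → ℤ) (f : ℕ → A → ℤ) →
  sumTo n (λ k → c k * ∑ L (f k)) ≡ ∑[ a ∈ L ] sumTo n (λ k → c k * f k a)
sumTo-*-∑ zero L c f = sym (∑-*ˡ L (c 0) (f 0))
sumTo-*-∑ (suc n) L c f = begin
  sumTo n (λ k → c k * ∑ L (f k)) + c (suc n) * ∑ L (f (suc n))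
    ≡⟨ cong₂ _+_ (sumTo-*-∑ n L c f) (sym (∑-*ˡ L (c (suc n)) (f (suc n)))) ⟩
  ∑[ a ∈ L ] sumTo n (λ k → c k * f k a) + ∑[ a ∈ L ] c (suc n) * f (suc n) a
    ≡⟨ ∑-+ L _ _ ⟨
  ∑[ a ∈ L ] sumTo (suc n) (λ k → c k * f k a) ∎

sumTo-𝟙≟-> : ∀ n {m} (f : ℕ → ℤ) → n < m → sumTo n (λ k → 𝟙 (m ≟ k) * f k) ≡ 0ℤ
sumTo-𝟙≟-> zero f 0<m = cong (_* f 0) (𝟙-no (ℕ.>⇒≢ 0<m) (_ ≟ 0))
sumTo-𝟙≟-> (suc n) f n<m =
  cong₂ _+_ (sumTo-𝟙≟-> n f (ℕ.<-trans (ℕ.n<1+n n) n<m)) (cong (_* f (suc n)) (𝟙-no (ℕ.>⇒≢ n<m) (_ ≟ suc n)))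

sumTo-𝟙≟ : ∀ n {m} (f : ℕ → ℤ) → m ≤ n → sumTo n (λ k → 𝟙 (m ≟ k) * f k) ≡ f m
sumTo-𝟙≟ zero f z≤n = *-identityˡ (f 0)
sumTo-𝟙≟ (suc n) {m} f m≤1+n with ℕ.m≤n⇒m<n∨m≡n m≤1+n
... | inj₁ m<1+n = begin
  sumTo n (λ k → 𝟙 (m ≟ k) * f k) + 𝟙 (m ≟ suc n) * f (suc n)
    ≡⟨ cong₂ _+_ (sumTo-𝟙≟ n f (ℕ.s≤s⁻¹ m<1+n)) (cong (_* f (suc n)) (𝟙-no (ℕ.<⇒≢ m<1+n) (m ≟ suc n))) ⟩
  f m + 0ℤ ≡⟨ +-identityʳ (f m) ⟩
  f m      ∎
... | inj₂ refl = begin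
  sumTo n (λ k → 𝟙 (suc n ≟ k) * f k) + 𝟙 (suc n ≟ suc n) * f (suc n)
    ≡⟨ cong₂ _+_ (sumTo-𝟙≟-> n f (ℕ.n<1+n n)) (cong (_* f (suc n)) (𝟙-yes refl (suc n ≟ suc n))) ⟩
  0ℤ + 1ℤ * f (suc n) ≡⟨ trans (+-identityˡ _) (*-identityˡ _) ⟩
  f (suc n)           ∎

words : ∀ n → List A → List (Vec A n)
words zero L = [ [] ]
words (suc n) L = concatMap (λ w → map (_∷ w) L) (words n L)

∑-words-suc : ∀ n (L : List A) (f : Vec A (suc n) → ℤ) →
  ∑ (words (suc n) L) f ≡ ∑[ w ∈ words n L ] ∑[ a ∈ L ] f (a ∷ w)
∑-words-suc n L f = trans (∑-concatMap _ (words n L) f) (∑-cong (words n L) (λ w → ∑-map (_∷ w) L f))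

∑-words-all : ∀ {p} {P : Pred A p} n (L : List A) (P? : Decidable P) (f : Vec A n → ℤ) →
  ∑[ w ∈ words n L ] (𝟙 (All.all? P? w) * f w) ≡ ∑ (words n (filter P? L)) f
∑-words-all zero L P? f = cong (_+ 0ℤ) (*-identityˡ (f []))
∑-words-all (suc n) L P? f = begin
  ∑[ w ∈ words (suc n) L ] (𝟙 (All.all? P? w) * f w)
    ≡⟨ ∑-words-suc n L _ ⟩
  ∑[ w ∈ words n L ] ∑[ a ∈ L ] (𝟙 (All.all? P? (a ∷ w)) * f (a ∷ w))
    ≡⟨ ∑-cong (words n L) (λ w → ∑-cong L (λ a →
         trans (cong (_* f (a ∷ w)) (𝟙-× (P? a) (All.all? P? w))) (*-assoc (𝟙 (P? a)) _ _))) ⟩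
  ∑[ w ∈ words n L ] ∑[ a ∈ L ] (𝟙 (P? a) * (𝟙 (All.all? P? w) * f (a ∷ w)))
    ≡⟨ ∑-cong (words n L) (λ w → ∑-filter P? L _) ⟩
  ∑[ w ∈ words n L ] ∑[ a ∈ L′ ] (𝟙 (All.all? P? w) * f (a ∷ w))
    ≡⟨ ∑-comm (words n L) L′ _ ⟩
  ∑[ a ∈ L′ ] ∑[ w ∈ words n L ] (𝟙 (All.all? P? w) * f (a ∷ w))
    ≡⟨ ∑-cong L′ (λ a → ∑-words-all n L P? (f ∘ (a ∷_))) ⟩
  ∑[ a ∈ L′ ] ∑[ w ∈ words n L′ ] f (a ∷ w)
    ≡⟨ ∑-comm (words n L′) L′ _ ⟨
  ∑[ w ∈ words n L′ ] ∑[ a ∈ L′ ] f (a ∷ w)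
    ≡⟨ ∑-words-suc n L′ f ⟨
  ∑ (words (suc n) L′) f ∎
  where
  L′ = filter P? L

∑-words-updateAt : ∀ (L : List A) {σ : A → A} → (∀ g → ∑[ a ∈ L ] g (σ a) ≡ ∑ L g) →
  ∀ {n} (i : Fin n) (f : Vec A n → ℤ) → ∑[ w ∈ words n L ] f (updateAt w i σ) ≡ ∑ (words n L) f
∑-words-updateAt L {σ} σ-invariant {suc n} i f = begin
  ∑[ w ∈ words (suc n) L ] f (updateAt w i σ)
    ≡⟨ ∑-words-suc n L _ ⟩
  ∑[ w ∈ words n L ] ∑[ a ∈ L ] f (updateAt (a ∷ w) i σ)
    ≡⟨ step i ⟩
  ∑[ w ∈ words n L ] ∑[ a ∈ L ] f (a ∷ w)
    ≡⟨ ∑-words-suc n L f ⟨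
  ∑ (words (suc n) L) f ∎
  where
  step : ∀ i → ∑[ w ∈ words n L ] ∑[ a ∈ L ] f (updateAt (a ∷ w) i σ)
             ≡ ∑[ w ∈ words n L ] ∑[ a ∈ L ] f (a ∷ w)
  step Fin.zero = ∑-cong (words n L) (λ w → σ-invariant (λ a → f (a ∷ w)))
  step (Fin.suc i) = ∑-words-updateAt L σ-invariant i (λ w → ∑[ a ∈ L ] f (a ∷ w))

subsets : ∀ n → List (Subset n)
subsets n = words n (outside ∷ inside ∷ [])

toggle : Fin n → Subset n → Subset n
toggle i p = updateAt p i not

toggle-involutive : ∀ (i : Fin n) p → toggle i (toggle i p) ≡ p
toggle-involutive i p = trans (updateAt-updateAt-local i p (not-involutive _)) (updateAt-id i p)

∑-subsets-toggle : ∀ (i : Fin n) (φ : Subset n → ℤ) → ∑[ p ∈ subsets n ] φ (toggle i p) ≡ ∑ (subsets n) φ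
∑-subsets-toggle = ∑-words-updateAt (outside ∷ inside ∷ []) not-invariant
  where
  not-invariant : ∀ g → g inside + (g outside + 0ℤ) ≡ g outside + (g inside + 0ℤ)
  not-invariant g = begin
    g inside + (g outside + 0ℤ)  ≡⟨ cong (_+_ (g inside)) (+-identityʳ _) ⟩
    g inside + g outside         ≡⟨ +-comm (g inside) _ ⟩
    g outside + g inside         ≡⟨ cong (_+_ (g outside)) (+-identityʳ _) ⟨
    g outside + (g inside + 0ℤ)  ∎

∑-sign-reversing : ∀ (i : Fin n) (φ : Subset n → ℤ) →
  (∀ p → lookup p i ≡ outside → φ (toggle i p) ≡ - φ p) → ∑ (subsets n) φ ≡ 0ℤ
∑-sign-reversing {n} i φ odd = i≡-i⇒i≡0 (begin
  ∑ (subsets n) φ                   ≡⟨ ∑-subsets-toggle i φ ⟨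
  ∑[ p ∈ subsets n ] φ (toggle i p) ≡⟨ ∑-cong (subsets n) odd′ ⟩
  ∑[ p ∈ subsets n ] - φ p          ≡⟨ ∑-neg (subsets n) φ ⟩
  - ∑ (subsets n) φ                 ∎)
  where
  odd′ : ∀ p → φ (toggle i p) ≡ - φ p
  odd′ p with lookup p i in p[i]≡
  ... | outside = odd p p[i]≡
  ... | inside = begin
    φ (toggle i p)               ≡⟨ neg-involutive _ ⟨
    - - φ (toggle i p)           ≡⟨ cong -_ (odd (toggle i p) i∉p′) ⟨
    - φ (toggle i (toggle i p))  ≡⟨ cong (-_ ∘ φ) (toggle-involutive i p) ⟩
    - φ p                        ∎
    where
    i∉p′ : lookup (toggle i p) i ≡ outside
    i∉p′ = trans (lookup∘updateAt i p) (cong not p[i]≡)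

select : (p : Subset n) → Vec A n → Vec A ∣ p ∣
select [] [] = []
select (outside ∷ p) (a ∷ w) = select p w
select (inside ∷ p) (a ∷ w) = a ∷ select p w

∸-suc : ∀ {k n} → suc k ≤ n → n ∸ k ≡ suc (n ∸ suc k)
∸-suc k<n = ℕ.+-∸-assoc 1 k<n

C-pow-pascal : ∀ n k M →
  (suc n C suc k) ℕ.* M ^ (n ∸ k) ≡ M ℕ.* ((n C suc k) ℕ.* M ^ (n ∸ suc k)) ℕ.+ (n C k) ℕ.* M ^ (n ∸ k)
C-pow-pascal n k M with suc k ≤? n
... | yes k<n = begin
  (suc n C suc k) ℕ.* M ^ (n ∸ k)                    ≡⟨ cong (λ e → (suc n C suc k) ℕ.* M ^ e) (∸-suc k<n) ⟩
  (suc n C suc k) ℕ.* (M ℕ.* Q)                      ≡⟨ cong (ℕ._* (M ℕ.* Q)) (nCk+nC[k+1]≡[n+1]C[k+1] n k) ⟨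
  ((n C k) ℕ.+ (n C suc k)) ℕ.* (M ℕ.* Q)            ≡⟨ rearrange (n C k) (n C suc k) M Q ⟩
  M ℕ.* ((n C suc k) ℕ.* Q) ℕ.+ (n C k) ℕ.* (M ℕ.* Q) ≡⟨ cong (λ e → M ℕ.* ((n C suc k) ℕ.* Q) ℕ.+ (n C k) ℕ.* M ^ e) (∸-suc k<n) ⟨
  M ℕ.* ((n C suc k) ℕ.* Q) ℕ.+ (n C k) ℕ.* M ^ (n ∸ k) ∎
  where
  Q = M ^ (n ∸ suc k)
  rearrange : ∀ a b M Q → (a ℕ.+ b) ℕ.* (M ℕ.* Q) ≡ M ℕ.* (b ℕ.* Q) ℕ.+ a ℕ.* (M ℕ.* Q)
  rearrange = solve-∀
... | no k≮n = begin
  (suc n C suc k) ℕ.* Q                            ≡⟨ cong (ℕ._* Q) (nCk+nC[k+1]≡[n+1]C[k+1] n k) ⟨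
  ((n C k) ℕ.+ (n C suc k)) ℕ.* Q                  ≡⟨ cong (λ c → ((n C k) ℕ.+ c) ℕ.* Q) nC[1+k]≡0 ⟩
  ((n C k) ℕ.+ 0) ℕ.* Q                            ≡⟨ cong (ℕ._* Q) (ℕ.+-identityʳ (n C k)) ⟩
  (n C k) ℕ.* Q                                    ≡⟨ cong (ℕ._+ (n C k) ℕ.* Q) (ℕ.*-zeroʳ M) ⟨
  M ℕ.* 0 ℕ.+ (n C k) ℕ.* Q                        ≡⟨ cong (λ c → M ℕ.* (c ℕ.* M ^ (n ∸ suc k)) ℕ.+ (n C k) ℕ.* Q) nC[1+k]≡0 ⟨
  M ℕ.* ((n C suc k) ℕ.* M ^ (n ∸ suc k)) ℕ.+ (n C k) ℕ.* Q ∎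
  where
  Q = M ^ (n ∸ k)
  nC[1+k]≡0 : n C suc k ≡ 0
  nC[1+k]≡0 = k>n⇒nCk≡0 (ℕ.≰⇒> k≮n)

pos-*-+ : ∀ m s a b → + m * (s * + a) + s * + b ≡ s * + (m ℕ.* a ℕ.+ b)
pos-*-+ m s a b = begin
  + m * (s * + a) + s * + b    ≡⟨ rearrange (+ m) s (+ a) (+ b) ⟩
  s * (+ m * + a + + b)        ≡⟨ cong (λ e → s * (e + + b)) (pos-* m a) ⟨
  s * (+ (m ℕ.* a) + + b)      ≡⟨ cong (s *_) (pos-+ (m ℕ.* a) b) ⟨
  s * + (m ℕ.* a ℕ.+ b)        ∎
  where
  rearrange : ∀ m s a b → m * (s * a) + s * b ≡ s * (m * a + b)
  rearrange = ℤ-solve-∀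

∑-words-select : ∀ n k (L : List A) (R : ∀ {m} → Vec A m → ℤ) →
  ∑[ w ∈ words n L ] ∑[ p ∈ subsets n ] 𝟙 (∣ p ∣ ≟ k) * R (select p w)
    ≡ ∑ (words k L) R * + ((n C k) ℕ.* length L ^ (n ∸ k))
∑-words-select zero zero L R = base (R [])
  where
  base : ∀ r → 1ℤ * r + 0ℤ + 0ℤ ≡ (r + 0ℤ) * 1ℤ
  base = ℤ-solve-∀
∑-words-select zero (suc k) L R = sym (*-zeroʳ (∑ (words (suc k) L) R))
∑-words-select (suc n) k L R = begin
  ∑[ w ∈ words (suc n) L ] ∑[ p ∈ subsets (suc n) ] 𝟙 (∣ p ∣ ≟ k) * R (select p w)
    ≡⟨ ∑-words-suc n L _ ⟩
  ∑[ w ∈ words n L ] ∑[ a ∈ L ] ∑[ p ∈ subsets (suc n) ] 𝟙 (∣ p ∣ ≟ k) * R (select p (a ∷ w))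
    ≡⟨ ∑-cong (words n L) (λ w → ∑-cong L (λ a → split w a)) ⟩
  ∑[ w ∈ words n L ] ∑[ a ∈ L ] (X w + Y a w)
    ≡⟨ ∑-cong (words n L) (λ w → trans (∑-+ L (λ _ → X w) (λ a → Y a w)) (cong (_+ ∑[ a ∈ L ] Y a w) (∑-const L (X w)))) ⟩
  ∑[ w ∈ words n L ] (+ M * X w + ∑[ a ∈ L ] Y a w)
    ≡⟨ ∑-+ (words n L) _ _ ⟩
  (∑[ w ∈ words n L ] + M * X w) + (∑[ w ∈ words n L ] ∑[ a ∈ L ] Y a w)
    ≡⟨ cong₂ _+_ (∑-*ˡ (words n L) (+ M) X) (∑-comm (words n L) L _) ⟩
  + M * ∑ (words n L) X + (∑[ a ∈ L ] ∑[ w ∈ words n L ] Y a w)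
    ≡⟨ cong (λ e → + M * e + (∑[ a ∈ L ] ∑[ w ∈ words n L ] Y a w)) (∑-words-select n k L R) ⟩
  + M * (∑ (words k L) R * + ((n C k) ℕ.* M ^ (n ∸ k))) + (∑[ a ∈ L ] ∑[ w ∈ words n L ] Y a w)
    ≡⟨ close k R ⟩
  ∑ (words k L) R * + ((suc n C k) ℕ.* M ^ (suc n ∸ k)) ∎
  where
  M = length L
  close : ∀ k (R : ∀ {m} → Vec _ m → ℤ) →
    + M * (∑ (words k L) R * + ((n C k) ℕ.* M ^ (n ∸ k)))
      + (∑[ a ∈ L ] ∑[ w ∈ words n L ] ∑[ p ∈ subsets n ] 𝟙 (suc ∣ p ∣ ≟ k) * R (a ∷ select p w))
      ≡ ∑ (words k L) R * + ((suc n C k) ℕ.* M ^ (suc n ∸ k))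
  close zero R = begin
    + M * (S * + ((n C 0) ℕ.* M ^ n)) + (∑[ a ∈ L ] ∑[ w ∈ words n L ] ∑[ p ∈ subsets n ] 0ℤ)
      ≡⟨ cong (_+_ (+ M * (S * + ((n C 0) ℕ.* M ^ n)))) (trans vanish (sym (*-zeroʳ S))) ⟩
    + M * (S * + ((n C 0) ℕ.* M ^ n)) + S * + 0
      ≡⟨ pos-*-+ M S ((n C 0) ℕ.* M ^ n) 0 ⟩
    S * + (M ℕ.* ((n C 0) ℕ.* M ^ n) ℕ.+ 0)
      ≡⟨ cong (λ e → S * + e) (C-pow-zero M (M ^ n)) ⟩
    S * + ((suc n C 0) ℕ.* M ^ suc n) ∎
    where
    S = ∑ (words 0 L) R
    C-pow-zero : ∀ M Q → M ℕ.* (1 ℕ.* Q) ℕ.+ 0 ≡ 1 ℕ.* (M ℕ.* Q)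
    C-pow-zero = solve-∀
    vanish : ∑[ a ∈ L ] ∑[ w ∈ words n L ] ∑[ p ∈ subsets n ] 0ℤ ≡ 0ℤ
    vanish = trans (∑-cong L (λ a → trans (∑-cong (words n L) (λ w → ∑-0 (subsets n))) (∑-0 (words n L)))) (∑-0 L)
  close (suc k) R = begin
    + M * (S * + ((n C suc k) ℕ.* M ^ (n ∸ suc k))) + (∑[ a ∈ L ] ∑[ w ∈ words n L ] Y′ a w)
      ≡⟨ cong (_+_ (+ M * (S * + ((n C suc k) ℕ.* M ^ (n ∸ suc k))))) tail-sum ⟩
    + M * (S * + ((n C suc k) ℕ.* M ^ (n ∸ suc k))) + S * + ((n C k) ℕ.* M ^ (n ∸ k))
      ≡⟨ pos-*-+ M S _ _ ⟩
    S * + (M ℕ.* ((n C suc k) ℕ.* M ^ (n ∸ suc k)) ℕ.+ (n C k) ℕ.* M ^ (n ∸ k))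
      ≡⟨ cong (λ e → S * + e) (C-pow-pascal n k M) ⟨
    S * + ((suc n C suc k) ℕ.* M ^ (n ∸ k)) ∎
    where
    S = ∑ (words (suc k) L) R
    Y′ : _ → Vec _ n → ℤ
    Y′ a w = ∑[ p ∈ subsets n ] 𝟙 (∣ p ∣ ≟ k) * R (a ∷ select p w)
    tail-sum : ∑[ a ∈ L ] ∑[ w ∈ words n L ] Y′ a w ≡ S * + ((n C k) ℕ.* M ^ (n ∸ k))
    tail-sum = begin
      ∑[ a ∈ L ] ∑[ w ∈ words n L ] Y′ a w
        ≡⟨ ∑-cong L (λ a → ∑-words-select n k L (λ G → R (a ∷ G))) ⟩
      ∑[ a ∈ L ] (∑[ G ∈ words k L ] R (a ∷ G)) * c
        ≡⟨ ∑-*ʳ L _ c ⟩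
      (∑[ a ∈ L ] ∑[ G ∈ words k L ] R (a ∷ G)) * c
        ≡⟨ cong (_* c) (trans (∑-comm L (words k L) _) (sym (∑-words-suc k L R))) ⟩
      S * c ∎
      where
      c = + ((n C k) ℕ.* M ^ (n ∸ k))
  X : Vec _ n → ℤ
  X w = ∑[ p ∈ subsets n ] 𝟙 (∣ p ∣ ≟ k) * R (select p w)
  Y : _ → Vec _ n → ℤ
  Y a w = ∑[ p ∈ subsets n ] 𝟙 (suc ∣ p ∣ ≟ k) * R (a ∷ select p w)
  split : ∀ w a → ∑[ p ∈ subsets (suc n) ] 𝟙 (∣ p ∣ ≟ k) * R (select p (a ∷ w)) ≡ X w + Y a w
  split w a = begin
    ∑[ p ∈ subsets (suc n) ] 𝟙 (∣ p ∣ ≟ k) * R (select p (a ∷ w))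
      ≡⟨ ∑-words-suc n _ _ ⟩
    ∑[ p ∈ subsets n ] (x p + (y p + 0ℤ))
      ≡⟨ ∑-cong (subsets n) (λ p → cong (_+_ (x p)) (+-identityʳ (y p))) ⟩
    ∑[ p ∈ subsets n ] (x p + y p)
      ≡⟨ ∑-+ (subsets n) x y ⟩
    X w + Y a w ∎
    where
    x y : Subset n → ℤ
    x p = 𝟙 (∣ p ∣ ≟ k) * R (select p w)
    y p = 𝟙 (suc ∣ p ∣ ≟ k) * R (a ∷ select p w)

letters : ℕ → List ℕ
letters M = applyUpTo suc M

tabulate-toℕ : ∀ (f : ℕ → A) n → List.tabulate {n = n} (f ∘ toℕ) ≡ applyUpTo f n
tabulate-toℕ f zero = refl
tabulate-toℕ f (suc n) = cong (f 0 ∷_) (tabulate-toℕ (f ∘ suc) n)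

filter-letters : ∀ {M} M′ → M ≤ M′ → filter (_≤? M) (letters M′) ≡ letters M
filter-letters zero z≤n = refl
filter-letters {M} (suc M′) M≤1+M′ with M ≟ suc M′
... | yes refl = filter-all (_≤? M) (applyUpTo⁺₁ suc M (λ i<M → i<M))
... | no M≢1+M′ = begin
  filter (_≤? M) (letters (suc M′))                             ≡⟨ cong (filter (_≤? M)) (applyUpTo-∷ʳ suc M′) ⟨
  filter (_≤? M) (letters M′ ++ [ suc M′ ])                     ≡⟨ filter-++ (_≤? M) (letters M′) _ ⟩
  filter (_≤? M) (letters M′) ++ filter (_≤? M) [ suc M′ ]    ≡⟨ cong₂ _++_ (filter-letters M′ M≤M′) (filter-reject (_≤? M) (ℕ.<⇒≱ M<1+M′)) ⟩
  letters M ++ []                                                  ≡⟨ ++-identityʳ (letters M) ⟩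
  letters M                                                        ∎
  where
  M<1+M′ : M < suc M′
  M<1+M′ = ℕ.≤∧≢⇒< M≤1+M′ M≢1+M′
  M≤M′ : M ≤ M′
  M≤M′ = ℕ.s≤s⁻¹ M<1+M′

words-allFuns : ∀ u {m} (e : Fin m → A) →
  map (λ g → tabulate (e ∘ g)) (allFuns u m) ≡ words u (map e (List.allFin m))
words-allFuns zero e = refl
words-allFuns (suc u) {m} e =
  trans (map-concatMap T _ (allFuns u m))
    (trans (concatMap-cong (λ g → trans (sym (map-∘ (List.allFin m))) (map-∘ (List.allFin m))) (allFuns u m))
      (trans (sym (concatMap-map (λ w → map (_∷ w) (map e (List.allFin m))) T (allFuns u m)))
        (cong (concatMap (λ w → map (_∷ w) (map e (List.allFin m)))) (words-allFuns u e))))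
  where
  T : ∀ {k} → (Fin k → Fin m) → Vec _ k
  T g = tabulate (e ∘ g)

∣toggle∣ : ∀ (i : Fin n) (p : Subset n) → lookup p i ≡ outside → ∣ toggle i p ∣ ≡ suc ∣ p ∣
∣toggle∣ Fin.zero (outside ∷ p) _ = refl
∣toggle∣ (Fin.suc i) (outside ∷ p) i∉p = ∣toggle∣ i p i∉p
∣toggle∣ (Fin.suc i) (inside ∷ p) i∉p = cong suc (∣toggle∣ i p i∉p)

select-All : ∀ {p} {P : Pred A p} (s : Subset n) {F : Vec A n} → All P F → All P (select s F)
select-All [] [] = []
select-All (outside ∷ s) (_ ∷ PF) = select-All s PF
select-All (inside ∷ s) (Pa ∷ PF) = Pa ∷ select-All s PF

module _ {p} {P : Pred A p} (P? : Decidable P) where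

  count-full : ∀ (w : Vec A n) → n ≤ Vec.count P? w → All P w
  count-full [] _ = []
  count-full (a ∷ w) n≤c with P? a
  ... | yes Pa = Pa ∷ count-full w (ℕ.s≤s⁻¹ n≤c)
  ... | no _ = ⊥-elim (ℕ.≤⇒≯ (count≤n P? w) n≤c)

  count-all : ∀ {w : Vec A n} → All P w → Vec.count P? w ≡ n
  count-all [] = refl
  count-all {w = a ∷ w} (Pa ∷ Pw) with P? a
  ... | yes _ = cong suc (count-all Pw)
  ... | no ¬Pa = ⊥-elim (¬Pa Pa)

  count-tabulate : ∀ {u} {B : Set} (f : B → A) (g : Fin u → B) →
    length (filter (P? ∘ f) (List.tabulate g)) ≡ Vec.count P? (tabulate (f ∘ g))
  count-tabulate {zero} f g = refl
  count-tabulate {suc u} f g with does (P? (f (g Fin.zero)))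
  ... | true = cong suc (count-tabulate f (g ∘ Fin.suc))
  ... | false = count-tabulate f (g ∘ Fin.suc)

  count-select-toggle : ∀ (i : Fin n) (s : Subset n) (F : Vec A n) → lookup s i ≡ outside → ¬ P (lookup F i) →
    Vec.count P? (select (toggle i s) F) ≡ Vec.count P? (select s F)
  count-select-toggle Fin.zero (outside ∷ s) (a ∷ F) _ ¬Pa with P? a
  ... | yes Pa = ⊥-elim (¬Pa Pa)
  ... | no _ = refl
  count-select-toggle (Fin.suc i) (outside ∷ s) (a ∷ F) i∉s = count-select-toggle i s F i∉s
  count-select-toggle (Fin.suc i) (inside ∷ s) (a ∷ F) i∉s ¬Pi with does (P? a)
  ... | true = cong suc (count-select-toggle i s F i∉s ¬Pi)
  ... | false = count-select-toggle i s F i∉s ¬Pi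

∀-Fin⇔∀-< : ∀ {m} {Q : ℕ → Set} → (∀ (j : Fin m) → Q (toℕ j)) ⇔ (∀ {j} → j < m → Q j)
∀-Fin⇔∀-< {m} {Q} = mk⇔ to from
  where
  to : (∀ (j : Fin m) → Q (toℕ j)) → (∀ {j} → j < m → Q j)
  to h j<m = subst Q (toℕ-fromℕ< j<m) (h (fromℕ< j<m))
  from : (∀ {j} → j < m → Q j) → (∀ (j : Fin m) → Q (toℕ j))
  from h j = h (toℕ<n j)

count≤ : ℕ → Vec ℕ n → ℕ
count≤ t = Vec.count (_≤? t)

Parking : (ℕ → ℕ) → Vec ℕ n → Set
Parking {n} x w = ∀ {j} → j < n → suc j ≤ count≤ (x (suc j)) w

parking? : ∀ x (w : Vec ℕ n) → Dec (Parking x w)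
parking? x w = Dec.map ∀-Fin⇔∀-< (Fin.all? (λ j → suc (toℕ j) ≤? count≤ (x (suc (toℕ j))) w))

IsParking⇔Parking : ∀ x u (f : Fin u → ℕ) → IsParking x u f ⇔ Parking x (tabulate f)
IsParking⇔Parking x u f = ⇔.trans (mk⇔ (λ h j → subst (suc (toℕ j) ≤_) (counts j) (h j))
                                       (λ h j → subst (suc (toℕ j) ≤_) (sym (counts j)) (h j)))
                                   ∀-Fin⇔∀-<
  where
  counts : ∀ (j : Fin u) → preimageCount f (x (suc (toℕ j))) ≡ count≤ (x (suc (toℕ j))) (tabulate f)
  counts j = count-tabulate (_≤? _) f (λ i → i)

P≡∑Parking : ∀ x u → + P x u ≡ ∑[ w ∈ words u (letters (x u)) ] 𝟙 (parking? x w)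
P≡∑Parking x u = begin
  + P x u
    ≡⟨ ∑-𝟙 (isParking? x u ∘ embed) (allFuns u (x u)) ⟨
  ∑[ g ∈ allFuns u (x u) ] 𝟙 (isParking? x u (embed g))
    ≡⟨ ∑-cong (allFuns u (x u)) (λ g → 𝟙-⇔ (IsParking⇔Parking x u (embed g)) (isParking? x u (embed g)) (parking? x (tabulate (embed g)))) ⟩
  ∑[ g ∈ allFuns u (x u) ] 𝟙 (parking? x (tabulate (embed g)))
    ≡⟨ ∑-map (tabulate ∘ embed) (allFuns u (x u)) _ ⟨
  ∑[ w ∈ map (tabulate ∘ embed) (allFuns u (x u)) ] 𝟙 (parking? x w)
    ≡⟨ cong (λ W → ∑[ w ∈ W ] 𝟙 (parking? x w)) (words-allFuns u (suc ∘ toℕ)) ⟩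
  ∑[ w ∈ words u (map (suc ∘ toℕ) (List.allFin (x u))) ] 𝟙 (parking? x w)
    ≡⟨ cong (λ L → ∑[ w ∈ words u L ] 𝟙 (parking? x w)) letters≡ ⟩
  ∑[ w ∈ words u (letters (x u)) ] 𝟙 (parking? x w) ∎
  where
  embed : (Fin u → Fin (x u)) → Fin u → ℕ
  embed g i = suc (toℕ (g i))
  letters≡ : map (suc ∘ toℕ) (List.allFin (x u)) ≡ letters (x u)
  letters≡ = trans (map-tabulate (λ i → i) (suc ∘ toℕ)) (tabulate-toℕ suc (x u))

Parking-bounded : ∀ x (w : Vec ℕ n) → Parking x w → All (_≤ x n) w
Parking-bounded {zero} x [] _ = []
Parking-bounded {suc n} x w parks = count-full (_≤? x (suc n)) w (parks (ℕ.n<1+n n))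

P≡∑Parking-letters : ∀ x u {M} → x u ≤ M → + P x u ≡ ∑[ w ∈ words u (letters M) ] 𝟙 (parking? x w)
P≡∑Parking-letters x u {M} xu≤M = begin
  + P x u
    ≡⟨ P≡∑Parking x u ⟩
  ∑[ w ∈ words u (letters (x u)) ] 𝟙 (parking? x w)
    ≡⟨ cong (λ L → ∑[ w ∈ words u L ] 𝟙 (parking? x w)) (filter-letters M xu≤M) ⟨
  ∑[ w ∈ words u (filter (_≤? x u) (letters M)) ] 𝟙 (parking? x w)
    ≡⟨ ∑-words-all u (letters M) (_≤? x u) _ ⟨
  ∑[ w ∈ words u (letters M) ] 𝟙 (All.all? (_≤? x u) w) * 𝟙 (parking? x w)
    ≡⟨ ∑-cong (words u (letters M)) (λ w → 𝟙-*-implied (Parking-bounded x w) (All.all? (_≤? x u) w) (parking? x w)) ⟩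
  ∑[ w ∈ words u (letters M) ] 𝟙 (parking? x w) ∎

P≡∑Parking-next : ∀ x → NonDecreasing x → ∀ u → + P x u ≡ ∑[ w ∈ words u (letters (x (suc u))) ] 𝟙 (parking? x w)
-- For u = 0 both sides are 1; no bound on x 0 is needed (and NonDecreasing gives none).
P≡∑Parking-next x mono zero = refl
P≡∑Parking-next x mono (suc u) = P≡∑Parking-letters x (suc u) (mono (suc u) (suc (suc u)) (s≤s z≤n) (ℕ.n≤1+n _))

Valid : (ℕ → ℕ) → ℕ → Vec ℕ n → Subset n → Set
Valid x k F p = All (_≤ x (suc k)) F × Parking x (select p F)

valid? : ∀ x k (F : Vec ℕ n) p → Dec (Valid x k F p)
valid? x k F p = All.all? (_≤? x (suc k)) F ×-dec parking? x (select p F)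

max-position : ∀ (F : Vec ℕ (suc n)) → ∃[ i ] All (_≤ lookup F i) F
max-position (a ∷ []) = Fin.zero , ℕ.≤-refl ∷ []
max-position (a ∷ b ∷ F) with max-position (b ∷ F)
... | i , F≤ with a ≤? lookup (b ∷ F) i
...   | yes a≤ = Fin.suc i , a≤ ∷ F≤
...   | no a≰ = Fin.zero , ℕ.≤-refl ∷ All.map (λ c≤ → ℕ.≤-trans c≤ (ℕ.<⇒≤ (ℕ.≰⇒> a≰))) F≤

negOnePow-∸-suc : ∀ {k n} → suc k ≤ n → negOnePow (suc (n ∸ suc k)) ≡ - negOnePow (suc (n ∸ k))
negOnePow-∸-suc k<n = sym (trans (cong (λ e → - negOnePow (suc e)) (∸-suc k<n)) (neg-involutive _))

module _ (x : ℕ → ℕ) (mono : NonDecreasing x) where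

  Valid-toggle-max : ∀ (F : Vec ℕ n) (i : Fin n) → All (_≤ lookup F i) F →
    ∀ p → lookup p i ≡ outside → Valid x ∣ p ∣ F p ⇔ Valid x (suc ∣ p ∣) F (toggle i p)
  Valid-toggle-max F i F≤m p i∉p = mk⇔ to from
    where
    K = ∣ p ∣
    m = lookup F i
    q = toggle i p
    ∣q∣≡1+K : ∣ q ∣ ≡ suc K
    ∣q∣≡1+K = ∣toggle∣ i p i∉p
    full : ∀ {t} (r : Subset _) → m ≤ t → count≤ t (select r F) ≡ ∣ r ∣
    full r m≤t = count-all (_≤? _) (select-All r (All.map (λ a≤m → ℕ.≤-trans a≤m m≤t) F≤m))
    same : ∀ {t} → ¬ m ≤ t → count≤ t (select q F) ≡ count≤ t (select p F)
    same = count-select-toggle (_≤? _) i p F i∉p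

    to : Valid x K F p → Valid x (suc K) F q
    to (F≤ , parks) = All.map (λ a≤ → ℕ.≤-trans a≤ x[1+K]≤x[2+K]) F≤ , parks′
      where
      x[1+K]≤x[2+K] : x (suc K) ≤ x (suc (suc K))
      x[1+K]≤x[2+K] = mono (suc K) (suc (suc K)) (s≤s z≤n) (ℕ.n≤1+n _)
      parks′ : Parking x (select q F)
      parks′ {j} j<∣q∣ with m ≤? x (suc j)
      ... | yes m≤ = subst (suc j ≤_) (sym (full q m≤)) j<∣q∣
      ... | no m≰ = subst (suc j ≤_) (sym (same m≰)) (parks j<K)
        where
        j<K : j < K
        j<K = ℕ.≤∧≢⇒< (ℕ.s≤s⁻¹ (subst (j <_) ∣q∣≡1+K j<∣q∣)) (λ { refl → m≰ (lookup⁺ F≤ i) })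

    from : Valid x (suc K) F q → Valid x K F p
    from (_ , parks′) = All.map (λ a≤ → ℕ.≤-trans a≤ m≤x[1+K]) F≤m , parks
      where
      K<∣q∣ : K < ∣ q ∣
      K<∣q∣ = subst (K <_) (sym ∣q∣≡1+K) (ℕ.n<1+n K)
      m≤x[1+K] : m ≤ x (suc K)
      m≤x[1+K] with m ≤? x (suc K)
      ... | yes m≤ = m≤
      ... | no m≰ = ⊥-elim (ℕ.≤⇒≯ (count≤n (_≤? _) (select p F)) (subst (suc K ≤_) (same m≰) (parks′ K<∣q∣)))
      parks : Parking x (select p F)
      parks {j} j<K with m ≤? x (suc j)
      ... | yes m≤ = subst (suc j ≤_) (sym (full p m≤)) j<K
      ... | no m≰ = subst (suc j ≤_) (same m≰) (parks′ (subst (j <_) (sym ∣q∣≡1+K) (ℕ.m≤n⇒m≤1+n j<K)))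

  ∑-alternating-Valid : ∀ {n} (F : Vec ℕ (suc n)) →
    ∑[ p ∈ subsets (suc n) ] negOnePow (suc (suc n ∸ ∣ p ∣)) * 𝟙 (valid? x ∣ p ∣ F p) ≡ 0ℤ
  ∑-alternating-Valid {n} F with max-position F
  ... | i , F≤m = ∑-sign-reversing i φ odd
    where
    φ : Subset (suc n) → ℤ
    φ p = negOnePow (suc (suc n ∸ ∣ p ∣)) * 𝟙 (valid? x ∣ p ∣ F p)
    odd : ∀ p → lookup p i ≡ outside → φ (toggle i p) ≡ - φ p
    odd p i∉p = begin
      φ (toggle i p)
        ≡⟨ cong (λ k → sign k * 𝟙 (valid? x k F (toggle i p))) ∣q∣≡1+K ⟩
      sign (suc K) * 𝟙 (valid? x (suc K) F (toggle i p))
        ≡⟨ cong₂ _*_ (negOnePow-∸-suc 1+K≤1+n) (𝟙-⇔ (⇔.sym (Valid-toggle-max F i F≤m p i∉p)) (valid? x (suc K) F (toggle i p)) (valid? x K F p)) ⟩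
      - sign K * 𝟙 (valid? x K F p)
        ≡⟨ neg-distribˡ-* (sign K) _ ⟨
      - φ p ∎
      where
      K = ∣ p ∣
      sign : ℕ → ℤ
      sign k = negOnePow (suc (suc n ∸ k))
      ∣q∣≡1+K : ∣ toggle i p ∣ ≡ suc K
      ∣q∣≡1+K = ∣toggle∣ i p i∉p
      1+K≤1+n : suc K ≤ suc n
      1+K≤1+n = subst (_≤ suc n) ∣q∣≡1+K (∣p∣≤n (toggle i p))

∑-Valid-of-size : ∀ x → NonDecreasing x → ∀ n k → k ≤ n →
  ∑[ F ∈ words n (letters (x (suc n))) ] ∑[ p ∈ subsets n ] 𝟙 (∣ p ∣ ≟ k) * 𝟙 (valid? x k F p)
    ≡ + (n C k) * (+ P x k * + (x (suc k) ^ (n ∸ k)))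
∑-Valid-of-size x mono n k k≤n = begin
  ∑[ F ∈ words n (letters (x (suc n))) ] ∑[ p ∈ subsets n ] 𝟙 (∣ p ∣ ≟ k) * 𝟙 (valid? x k F p)
    ≡⟨ ∑-cong (words n _) (λ F → trans (∑-cong (subsets n) (λ p → split F p)) (∑-*ˡ (subsets n) (𝟙 (All.all? (_≤? X) F)) _)) ⟩
  ∑[ F ∈ words n (letters (x (suc n))) ] 𝟙 (All.all? (_≤? X) F) * Σ F
    ≡⟨ ∑-words-all n (letters (x (suc n))) (_≤? X) Σ ⟩
  ∑[ F ∈ words n (filter (_≤? X) (letters (x (suc n)))) ] Σ F
    ≡⟨ cong (λ L → ∑[ F ∈ words n L ] Σ F) (filter-letters (x (suc n)) (mono (suc k) (suc n) (s≤s z≤n) (s≤s k≤n))) ⟩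
  ∑[ F ∈ words n (letters X) ] Σ F
    ≡⟨ ∑-words-select n k (letters X) (𝟙 ∘ parking? x) ⟩
  (∑[ w ∈ words k (letters X) ] 𝟙 (parking? x w)) * + ((n C k) ℕ.* length (letters X) ^ (n ∸ k))
    ≡⟨ cong₂ (λ S M → S * + ((n C k) ℕ.* M ^ (n ∸ k))) (P≡∑Parking-next x mono k) (sym (length-applyUpTo suc X)) ⟨
  + P x k * + ((n C k) ℕ.* X ^ (n ∸ k))
    ≡⟨ pos-rearrange (+ P x k) (n C k) (X ^ (n ∸ k)) ⟩
  + (n C k) * (+ P x k * + (X ^ (n ∸ k))) ∎
  where
  X = x (suc k)
  Σ : Vec ℕ n → ℤ
  Σ F = ∑[ p ∈ subsets n ] 𝟙 (∣ p ∣ ≟ k) * 𝟙 (parking? x (select p F))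
  split : ∀ F p → 𝟙 (∣ p ∣ ≟ k) * 𝟙 (valid? x k F p)
                ≡ 𝟙 (All.all? (_≤? X) F) * (𝟙 (∣ p ∣ ≟ k) * 𝟙 (parking? x (select p F)))
  split F p = trans (cong (𝟙 (∣ p ∣ ≟ k) *_) (𝟙-× (All.all? (_≤? X) F) (parking? x (select p F))))
                    (swap (𝟙 (∣ p ∣ ≟ k)) (𝟙 (All.all? (_≤? X) F)) (𝟙 (parking? x (select p F))))
    where
    swap : ∀ d a b → d * (a * b) ≡ a * (d * b)
    swap = ℤ-solve-∀
  pos-rearrange : ∀ s c e → s * + (c ℕ.* e) ≡ + c * (s * + e)
  pos-rearrange s c e = trans (cong (s *_) (pos-* c e)) (rearrange s (+ c) (+ e))
    where
    rearrange : ∀ s c e → s * (c * e) ≡ c * (s * e)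
    rearrange = ℤ-solve-∀

proposition4 : (x : ℕ → ℕ) → NonDecreasing x → (n : ℕ) → 1 ≤ n →
    + 0 ≡ sumTo n (λ k → negOnePow (suc (n ∸ k)) * (+ (n C k) * (+ P x k * + (x (suc k) ^ (n ∸ k)))))
proposition4 x mono (suc n) _ = sym (begin
  sumTo N (λ k → sign k * (+ (N C k) * (+ P x k * + (x (suc k) ^ (N ∸ k)))))
    ≡⟨ sumTo-cong N (λ k k≤N → cong (sign k *_) (∑-Valid-of-size x mono N k k≤N)) ⟨
  sumTo N (λ k → sign k * (∑[ F ∈ W ] ∑[ p ∈ subsets N ] 𝟙 (∣ p ∣ ≟ k) * 𝟙 (valid? x k F p)))
    ≡⟨ trans (sumTo-*-∑ N W sign _) (∑-cong W (λ F → sumTo-*-∑ N (subsets N) sign _)) ⟩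
  ∑[ F ∈ W ] ∑[ p ∈ subsets N ] sumTo N (λ k → sign k * (𝟙 (∣ p ∣ ≟ k) * 𝟙 (valid? x k F p)))
    ≡⟨ ∑-cong W (λ F → ∑-cong (subsets N) (collapse F)) ⟩
  ∑[ F ∈ W ] ∑[ p ∈ subsets N ] sign ∣ p ∣ * 𝟙 (valid? x ∣ p ∣ F p)
    ≡⟨ ∑-cong W (∑-alternating-Valid x mono) ⟩
  ∑[ F ∈ W ] 0ℤ
    ≡⟨ ∑-0 W ⟩
  0ℤ ∎)
  where
  N = suc n
  W = words N (letters (x (suc N)))
  sign : ℕ → ℤ
  sign k = negOnePow (suc (N ∸ k))
  collapse : ∀ F p → sumTo N (λ k → sign k * (𝟙 (∣ p ∣ ≟ k) * 𝟙 (valid? x k F p))) ≡ sign ∣ p ∣ * 𝟙 (valid? x ∣ p ∣ F p)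
  collapse F p = trans (sumTo-cong N (λ k _ → swap (sign k) (𝟙 (∣ p ∣ ≟ k)) (𝟙 (valid? x k F p))))
                       (sumTo-𝟙≟ N (λ k → sign k * 𝟙 (valid? x k F p)) (∣p∣≤n p))
    where
    swap : ∀ a d b → a * (d * b) ≡ d * (a * b)
    swap = ℤ-solve-∀
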